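{- Let $G$ be a graph with an odd number $n\geq 9$ of vertices, and let $\overline{G}$ be its complement. Then $\mathrm{mp}(G)+\mathrm{mp}(\overline{G})=2n-3$ if and only if $G=K_n$ or $\overline{G}=K_n$.
   Context: All graphs are finite, simple and undirected; $\overline{G}$ is the complement of $G$. A perfect matching is a set of edges covering every vertex exactly once; an almost-perfect matching is a set of edges covering every vertex except one exactly once and missing the remaining vertex. The matching preclusion number $\mathrm{mp}(G)$ is the minimum number of edges whose deletion leaves a graph with neither a perfect matching nor an almost-perfect matching ($\mathrm{mp}(G)=0$ if $G$ has neither). -}

module Defs where

open import Data.Nat using (ℕ; zero; suc; _+_; _<ᵇ_)
open import Data.Bool using (Bool; true; false; not; _∧_; if_then_else_)
open import Data.Fin using (Fin; toℕ; _≟_)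
open import Data.Product using (Σ; ∃; _×_; _,_)
open import Data.Sum using (_⊎_)
open import Relation.Nullary using (¬_; yes; no)
open import Relation.Binary.PropositionalEquality using (_≡_; _≢_; refl; sym)

sumFin : ∀ {n} → (Fin n → ℕ) → ℕ
sumFin {zero} f = 0
sumFin {suc n} f = f Fin.zero + sumFin (λ i → f (Fin.suc i))

b2n : Bool → ℕ
b2n true = 1
b2n false = 0

record Graph (n : ℕ) : Set where
  field
    adj    : Fin n → Fin n → Bool
    adj-sym    : ∀ i j → adj i j ≡ adj j i
    adj-irrefl : ∀ i → adj i i ≡ false
open Graph public

compAdj : ∀ {n} → (Fin n → Fin n → Bool) → Fin n → Fin n → Bool
compAdj a i j with i ≟ j
... | yes _ = false
... | no _  = not (a i j)

complement : ∀ {n} → Graph n → Graph n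
complement {n} G = record { adj = compAdj (adj G) ; adj-sym = s ; adj-irrefl = r }
  where
  s : ∀ i j → compAdj (adj G) i j ≡ compAdj (adj G) j i
  s i j with i ≟ j | j ≟ i
  ... | yes _ | yes _ = refl
  ... | yes p | no q = Data.Empty.⊥-elim (q (sym p))
    where import Data.Empty
  ... | no p | yes q = Data.Empty.⊥-elim (p (sym q))
    where import Data.Empty
  ... | no _ | no _ rewrite adj-sym G i j = refl
  r : ∀ i → compAdj (adj G) i i ≡ false
  r i with i ≟ i
  ... | yes _ = refl
  ... | no p = Data.Empty.⊥-elim (p refl)
    where import Data.Empty

IsComplete : ∀ {n} → Graph n → Set
IsComplete G = ∀ i j → i ≢ j → adj G i j ≡ true

record EdgeSubset {n} (G : Graph n) : Set where
  field
    mem     : Fin n → Fin n → Bool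
    mem-sym : ∀ i j → mem i j ≡ mem j i
    mem-sub : ∀ i j → mem i j ≡ true → adj G i j ≡ true
open EdgeSubset public

size : ∀ {n} {G : Graph n} → EdgeSubset G → ℕ
size F = sumFin λ i → sumFin λ j → b2n ((toℕ i <ᵇ toℕ j) ∧ mem F i j)

degIn : ∀ {n} {G : Graph n} → EdgeSubset G → Fin n → ℕ
degIn F v = sumFin λ w → b2n (mem F v w)

deleteEdges : ∀ {n} (G : Graph n) → EdgeSubset G → Graph n
deleteEdges G F = record
  { adj = λ i j → adj G i j ∧ not (mem F i j)
  ; adj-sym = λ i j → Relation.Binary.PropositionalEquality.cong₂ (λ a b → a ∧ not b) (adj-sym G i j) (mem-sym F i j)
  ; adj-irrefl = λ i → Relation.Binary.PropositionalEquality.cong (λ a → a ∧ not (mem F i i)) (adj-irrefl G i)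
  }

HasPerfectMatching : ∀ {n} → Graph n → Set
HasPerfectMatching G = Σ (EdgeSubset G) λ M → ∀ v → degIn M v ≡ 1

HasAlmostPerfectMatching : ∀ {n} → Graph n → Set
HasAlmostPerfectMatching G =
  Σ (EdgeSubset G) λ M → Σ (Fin _) λ u →
    (degIn M u ≡ 0) × (∀ v → v ≢ u → degIn M v ≡ 1)

IsPreclusionSet : ∀ {n} (G : Graph n) → EdgeSubset G → Set
IsPreclusionSet G F =
  ¬ HasPerfectMatching (deleteEdges G F) × ¬ HasAlmostPerfectMatching (deleteEdges G F)

-- mp(G) = k : k is the minimum size of a matching preclusion set
-- (if G has neither matching, the empty set is one, so k = 0)
IsMP : ∀ {n} → Graph n → ℕ → Set
IsMP G k =
  (Σ (EdgeSubset G) λ F → IsPreclusionSet G F × size F ≡ k)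
  × (∀ F → IsPreclusionSet G F → k Data.Nat.≤ size F)

module Submission where

-- For distinct p, q let T_G(p, q) (`incident`) be the set of edges of G meeting p or q.
-- Deleting it isolates p and q, so mp(G) ≤ |T_G(p, q)|, and since every other vertex is
-- adjacent to p (to q) in exactly one of G and its complement,
-- |T_G(p, q)| + |T_Ḡ(p, q)| = 2n − 3.
--
-- (⇐) An edgeless graph has mp = 0, and mp(K_n) = 2n − 3: T gives the upper bound; the
-- lower bound is the main combinatorial lemma `nearPerfect`: a set of 2k+1 vertices with
-- at most oddBound k (= 4k − 2 for k ≥ 4) forbidden pairs has a near-perfect matching
-- avoiding them.  It is proved with its even analogue `perfect` by induction: a vertex u
-- of maximum forbidden degree is matched with a well-chosen non-neighbour (or, having
-- none, is left uncovered) and the rest is matched recursively; the handshake lemma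
-- and the arithmetic facts `oddStep`/`evenStep` show the remainder still has few pairs.
--
-- (⇒) If the sum is 2n − 3, minimality forces |T_G(p, q)| = mp(G) for every pair.  A
-- vertex x with a neighbour y and a non-neighbour z then makes y adjacent and z
-- non-adjacent to all other vertices with deg y = deg z + 1, impossible once n ≥ 5;
-- but a graph that is neither complete nor edgeless has such a vertex.

open import Defs
open import Data.Nat using (ℕ; zero; suc; _+_; _*_; _∸_; _≤_; _<_; _%_; _/_; _<ᵇ_; z≤n; s≤s; _≤?_; _<?_; ⌊_/2⌋)
open import Data.Nat.DivMod using (m≡m%n+[m/n]*n)
open import Data.Nat.Properties hiding (_≟_)
open import Data.Bool using (Bool; true; false; not; _∧_; _∨_)
import Data.Bool.Properties as Boolᵖ
open import Data.Fin using (Fin; zero; suc; toℕ; _≟_)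
open import Data.Fin.Properties using (toℕ-injective; any?) renaming (suc-injective to Fin-suc-injective)
open import Data.Product using (Σ; _×_; _,_; proj₁; proj₂)
open import Data.Sum using (_⊎_; inj₁; inj₂)
open import Data.Empty using (⊥; ⊥-elim)
open import Function.Base using (_∘_)
open import Function.Bundles using (_⇔_; mk⇔; module Equivalence)
open import Relation.Nullary using (¬_; yes; no; Dec)
open import Relation.Nullary.Decidable using (⌊_⌋; _×-dec_; ¬?)
open import Relation.Binary.PropositionalEquality
open import Data.Nat.Tactic.RingSolver using (solve-∀)
open import Algebra.Properties.CommutativeMonoid.Sum +-0-commutativeMonoid
  using (sum; ∑-distrib-+; ∑-comm)
open import Algebra.Properties.Semiring.Sum +-*-semiring using (*-distribˡ-sum)
open ≡-Reasoning

sumFin≡sum : ∀ {n} (f : Fin n → ℕ) → sumFin f ≡ sum f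
sumFin≡sum {zero}  f = refl
sumFin≡sum {suc n} f = cong (f zero +_) (sumFin≡sum (λ i → f (suc i)))

sumFin-cong : ∀ {n} {f g : Fin n → ℕ} → (∀ i → f i ≡ g i) → sumFin f ≡ sumFin g
sumFin-cong {zero}  h = refl
sumFin-cong {suc n} h = cong₂ _+_ (h zero) (sumFin-cong (λ i → h (suc i)))

sumFin-mono : ∀ {n} {f g : Fin n → ℕ} → (∀ i → f i ≤ g i) → sumFin f ≤ sumFin g
sumFin-mono {zero}  h = z≤n
sumFin-mono {suc n} h = +-mono-≤ (h zero) (sumFin-mono (λ i → h (suc i)))

sumFin-+ : ∀ {n} (f g : Fin n → ℕ) → sumFin (λ i → f i + g i) ≡ sumFin f + sumFin g
sumFin-+ f g = begin
  sumFin (λ i → f i + g i) ≡⟨ sumFin≡sum (λ i → f i + g i) ⟩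
  sum (λ i → f i + g i)    ≡⟨ ∑-distrib-+ f g ⟩
  sum f + sum g            ≡⟨ sym (cong₂ _+_ (sumFin≡sum f) (sumFin≡sum g)) ⟩
  sumFin f + sumFin g      ∎

sumFin-*ˡ : ∀ {n} (c : ℕ) (f : Fin n → ℕ) → sumFin (λ i → c * f i) ≡ c * sumFin f
sumFin-*ˡ c f = begin
  sumFin (λ i → c * f i) ≡⟨ sumFin≡sum (λ i → c * f i) ⟩
  sum (λ i → c * f i)    ≡⟨ sym (*-distribˡ-sum c f) ⟩
  c * sum f              ≡⟨ cong (c *_) (sym (sumFin≡sum f)) ⟩
  c * sumFin f           ∎

sumFin-comm : ∀ {n} (f : Fin n → Fin n → ℕ) →
              sumFin (λ i → sumFin (λ j → f i j)) ≡ sumFin (λ j → sumFin (λ i → f i j))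
sumFin-comm {n} f = begin
  sumFin (λ i → sumFin (λ j → f i j)) ≡⟨ sumFin-cong (λ i → sumFin≡sum {n} (f i)) ⟩
  sumFin (λ i → sum (λ j → f i j))    ≡⟨ sumFin≡sum (λ i → sum (λ j → f i j)) ⟩
  sum (λ i → sum (λ j → f i j))       ≡⟨ ∑-comm f ⟩
  sum (λ j → sum (λ i → f i j))       ≡⟨ sym (sumFin≡sum (λ j → sum (λ i → f i j))) ⟩
  sumFin (λ j → sum (λ i → f i j))    ≡⟨ sumFin-cong (λ j → sym (sumFin≡sum {n} (λ i → f i j))) ⟩
  sumFin (λ j → sumFin (λ i → f i j)) ∎

sumFin-zero : ∀ {n} (f : Fin n → ℕ) → (∀ i → f i ≡ 0) → sumFin f ≡ 0
sumFin-zero {zero}  f h = refl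
sumFin-zero {suc n} f h rewrite h zero = sumFin-zero (λ i → f (suc i)) (λ i → h (suc i))

sumFin-ones : ∀ {n} → sumFin {n} (λ _ → 1) ≡ n
sumFin-ones {zero}  = refl
sumFin-ones {suc n} = cong suc (sumFin-ones {n})

sumFin-single : ∀ {n} (f : Fin n → ℕ) (k : Fin n) → (∀ j → j ≢ k → f j ≡ 0) → sumFin f ≡ f k
sumFin-single f zero h =
  trans (cong (f zero +_) (sumFin-zero _ (λ i → h (suc i) (λ ())))) (+-identityʳ _)
sumFin-single f (suc k) h =
  trans (cong (_+ sumFin (λ i → f (suc i))) (h zero (λ ())))
        (sumFin-single (λ i → f (suc i)) k (λ j j≢k → h (suc j) (λ e → j≢k (Fin-suc-injective e))))

sumFin-term : ∀ {n} (f : Fin n → ℕ) (k : Fin n) → f k ≤ sumFin f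
sumFin-term f zero    = m≤m+n _ _
sumFin-term f (suc k) = ≤-trans (sumFin-term (λ i → f (suc i)) k) (m≤n+m _ _)

sumFin-< : ∀ {n} (f g : Fin n → ℕ) → sumFin f < sumFin g → Σ (Fin n) λ i → f i < g i
sumFin-< {zero}  f g ()
sumFin-< {suc n} f g lt with f zero <? g zero
... | yes p = zero , p
... | no p with sumFin-< (λ i → f (suc i)) (λ i → g (suc i))
                 (+-cancelˡ-< (g zero) _ _ (≤-<-trans (+-monoˡ-≤ _ (≮⇒≥ p)) lt))
...   | i , q = suc i , q

argmax : ∀ {n} → Fin n → (f : Fin n → ℕ) → Σ (Fin n) λ u → ∀ w → f w ≤ f u
argmax {suc zero} _ f = zero , λ { zero → ≤-refl }
argmax {suc (suc n)} _ f with argmax zero (λ i → f (suc i))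
... | u , best with f zero ≤? f (suc u)
...   | yes p = suc u , λ { zero → p ; (suc w) → best w }
...   | no p  = zero , λ { zero → ≤-refl ; (suc w) → ≤-trans (best w) (<⇒≤ (≰⇒> p)) }

b2n≤1 : ∀ a → b2n a ≤ 1
b2n≤1 true  = s≤s z≤n
b2n≤1 false = z≤n

b2n-∧ : ∀ a b → b2n (a ∧ b) ≡ b2n a * b2n b
b2n-∧ true  b = sym (+-identityʳ (b2n b))
b2n-∧ false b = refl

b2n-not : ∀ a → b2n a + b2n (not a) ≡ 1
b2n-not true  = refl
b2n-not false = refl

eqᵇ : ∀ {n} → Fin n → Fin n → Bool
eqᵇ x u = ⌊ x ≟ u ⌋

eqᵇ-refl : ∀ {n} (x : Fin n) → eqᵇ x x ≡ true
eqᵇ-refl x with x ≟ x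
... | yes _  = refl
... | no x≢x = ⊥-elim (x≢x refl)

eqᵇ-≢ : ∀ {n} {x u : Fin n} → x ≢ u → eqᵇ x u ≡ false
eqᵇ-≢ {x = x} {u} x≢u with x ≟ u
... | yes x≡u = ⊥-elim (x≢u x≡u)
... | no _    = refl

eqᵇ-true : ∀ {n} {x u : Fin n} → eqᵇ x u ≡ true → x ≡ u
eqᵇ-true {x = x} {u} e with x ≟ u
... | yes x≡u = x≡u

sumFin-pick : ∀ {n} (u : Fin n) (g : Fin n → ℕ) → sumFin (λ x → b2n (eqᵇ x u) * g x) ≡ g u
sumFin-pick u g = begin
  sumFin (λ x → b2n (eqᵇ x u) * g x)
    ≡⟨ sumFin-single _ u (λ x x≢u → cong (λ b → b2n b * g x) (eqᵇ-≢ x≢u)) ⟩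
  b2n (eqᵇ u u) * g u ≡⟨ cong (λ b → b2n b * g u) (eqᵇ-refl u) ⟩
  1 * g u             ≡⟨ *-identityˡ (g u) ⟩
  g u                 ∎

sumFin-point : ∀ {n} (u : Fin n) → sumFin (λ x → b2n (eqᵇ x u)) ≡ 1
sumFin-point u = trans (sumFin-cong (λ x → sym (*-identityʳ (b2n (eqᵇ x u))))) (sumFin-pick u (λ _ → 1))

-- oddBound k: how many forbidden pairs a set of 2k+1 vertices always tolerates while
-- keeping a near-perfect matching; from k = 4 on it is 4k − 2, i.e. 2(2k+1) − 4.
oddBound : ℕ → ℕ
oddBound 0 = 0
oddBound 1 = 2
oddBound 2 = 5
oddBound 3 = 9
oddBound (suc (suc (suc (suc j)))) = 14 + 4 * j

-- evenBound k: the analogue for 2k vertices and perfect matchings, namely 2k − 2.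
evenBound : ℕ → ℕ
evenBound zero    = 0
evenBound (suc k) = k + k

-- What is known when the vertex u of maximum degree Δ, in a set of N vertices with
-- m forbidden pairs, is matched with a non-neighbour v of degree d: either d ≥ 1
-- (together with the handshake bound 2m ≤ NΔ), or every non-neighbour of u is
-- isolated, so all forbidden pairs meet u or its Δ neighbours: 2m ≤ (Δ + 1)Δ.
PairCert : ℕ → ℕ → ℕ → ℕ → Set
PairCert N m d Δ = (1 ≤ d × m + m ≤ N * Δ) ⊎ (m + m ≤ suc Δ * Δ)

halve : ∀ m q → m + m ≤ suc (q + q) → m ≤ q
halve m q h with m ≤? q
... | yes m≤q = m≤q
... | no m≰q = ⊥-elim (<-irrefl refl (≤-trans (≤-reflexive (sym (cong suc (+-suc q q))))
                                                (≤-trans (+-mono-≤ (≰⇒> m≰q) (≰⇒> m≰q)) h)))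

halve′ : ∀ m q → m + m ≤ q + q → m ≤ q
halve′ m q h = halve m q (m≤n⇒m≤1+n h)

≤-by : ∀ a b c → a + c ≡ b → a ≤ b
≤-by a b c e = ≤-trans (m≤m+n a c) (≤-reflexive e)

≤0⇒≤ : ∀ {m} x → m ≤ 0 → m ≤ x
≤0⇒≤ x h rewrite n≤0⇒n≡0 h = z≤n

Δ0⇒noPairs : ∀ m N → m + m ≤ N * 0 → m ≤ 0
Δ0⇒noPairs m N h rewrite *-zeroʳ N = halve m 0 (m≤n⇒m≤1+n h)

Δ≤2⇒m≤N : ∀ m N Δ → Δ ≤ 2 → m + m ≤ N * Δ → m ≤ N
Δ≤2⇒m≤N m N Δ Δ≤2 h = halve′ m N (≤-trans h (≤-trans (*-monoʳ-≤ N Δ≤2) (≤-reflexive (twice N))))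
  where
  twice : ∀ N → N * 2 ≡ N + N
  twice = solve-∀

-- The four arithmetic facts driving the pair-removal induction: after deleting the
-- pair, the remaining forbidden pairs fit the bound for two vertices fewer.  When Δ is
-- large, m ≤ oddBound (k+1) suffices; when Δ is small, the handshake bound does; the
-- values k ≤ 3 (where oddBound is not yet linear) are checked case by case.
oddBound-stepA : ∀ k m Δ → m ≤ oddBound (suc k) → m + m ≤ suc (suc k + suc k) * Δ →
                 m ≤ oddBound k + (1 + Δ)
oddBound-stepA k m zero h1 h2 = ≤0⇒≤ _ (Δ0⇒noPairs m (suc (suc k + suc k)) h2)
oddBound-stepA 0 m (suc Δ) h1 h2 = ≤-trans h1 (m≤m+n 2 Δ)
oddBound-stepA 1 m 1 h1 h2 = ≤-trans (halve m 2 h2) (m≤m+n 2 2)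
oddBound-stepA 1 m (suc (suc Δ)) h1 h2 = ≤-trans h1 (m≤m+n 5 Δ)
oddBound-stepA 2 m 1 h1 h2 = ≤-trans (halve m 3 h2) (m≤m+n 3 4)
oddBound-stepA 2 m 2 h1 h2 = ≤-trans (halve′ m 7 h2) (m≤m+n 7 1)
oddBound-stepA 2 m (suc (suc (suc Δ))) h1 h2 = ≤-trans h1 (m≤m+n 9 Δ)
oddBound-stepA 3 m 1 h1 h2 = ≤-trans (halve m 4 h2) (m≤m+n 4 7)
oddBound-stepA 3 m 2 h1 h2 = ≤-trans (halve′ m 9 h2) (m≤m+n 9 3)
oddBound-stepA 3 m 3 h1 h2 = halve m 13 h2
oddBound-stepA 3 m (suc (suc (suc (suc Δ)))) h1 h2 = ≤-trans h1 (m≤m+n 14 Δ)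
oddBound-stepA (suc (suc (suc (suc j)))) m 1 h1 h2 =
  ≤-trans (Δ≤2⇒m≤N m _ 1 (s≤s z≤n) h2) (≤-by _ _ (5 + (j + j)) (eq j))
  where
  eq : ∀ j → suc (suc (4 + j) + suc (4 + j)) + (5 + (j + j)) ≡ 14 + 4 * j + (1 + 1)
  eq = solve-∀
oddBound-stepA (suc (suc (suc (suc j)))) m 2 h1 h2 =
  ≤-trans (Δ≤2⇒m≤N m _ 2 (s≤s (s≤s z≤n)) h2) (≤-by _ _ (6 + (j + j)) (eq j))
  where
  eq : ∀ j → suc (suc (4 + j) + suc (4 + j)) + (6 + (j + j)) ≡ 14 + 4 * j + (1 + 2)
  eq = solve-∀
oddBound-stepA (suc (suc (suc (suc j)))) m (suc (suc (suc Δ))) h1 h2 =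
  ≤-trans h1 (≤-by _ _ Δ (eq j Δ))
  where
  eq : ∀ j Δ → 14 + 4 * suc j + Δ ≡ 14 + 4 * j + (1 + (3 + Δ))
  eq = solve-∀

-- The same with the bound 2m ≤ (Δ + 1)Δ, valid when all non-neighbours of u are isolated.
oddBound-stepB : ∀ k m Δ → m ≤ oddBound (suc k) → m + m ≤ suc Δ * Δ → m ≤ oddBound k + Δ
oddBound-stepB k m 0 h1 h2 = ≤0⇒≤ _ (halve m 0 (m≤n⇒m≤1+n h2))
oddBound-stepB 0 m 1 h1 h2 = halve m 1 (m≤n⇒m≤1+n h2)
oddBound-stepB 0 m (suc (suc Δ)) h1 h2 = ≤-trans h1 (m≤m+n 2 Δ)
oddBound-stepB 1 m 1 h1 h2 = ≤-trans (halve′ m 1 h2) (m≤m+n 1 2)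
oddBound-stepB 1 m 2 h1 h2 = ≤-trans (halve′ m 3 h2) (m≤m+n 3 1)
oddBound-stepB 1 m (suc (suc (suc Δ))) h1 h2 = ≤-trans h1 (m≤m+n 5 Δ)
oddBound-stepB 2 m 1 h1 h2 = ≤-trans (halve′ m 1 h2) (m≤m+n 1 5)
oddBound-stepB 2 m 2 h1 h2 = ≤-trans (halve′ m 3 h2) (m≤m+n 3 4)
oddBound-stepB 2 m 3 h1 h2 = ≤-trans (halve′ m 6 h2) (m≤m+n 6 2)
oddBound-stepB 2 m (suc (suc (suc (suc Δ)))) h1 h2 = ≤-trans h1 (m≤m+n 9 Δ)
oddBound-stepB 3 m 1 h1 h2 = ≤-trans (halve′ m 1 h2) (m≤m+n 1 9)
oddBound-stepB 3 m 2 h1 h2 = ≤-trans (halve′ m 3 h2) (m≤m+n 3 8)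
oddBound-stepB 3 m 3 h1 h2 = ≤-trans (halve′ m 6 h2) (m≤m+n 6 6)
oddBound-stepB 3 m 4 h1 h2 = ≤-trans (halve′ m 10 h2) (m≤m+n 10 3)
oddBound-stepB 3 m (suc (suc (suc (suc (suc Δ))))) h1 h2 = ≤-trans h1 (m≤m+n 14 Δ)
oddBound-stepB (suc (suc (suc (suc j)))) m 1 h1 h2 = ≤-trans (halve′ m 1 h2) (≤-by 1 _ (14 + 4 * j) (eq j))
  where
  eq : ∀ j → 1 + (14 + 4 * j) ≡ 14 + 4 * j + 1
  eq = solve-∀
oddBound-stepB (suc (suc (suc (suc j)))) m 2 h1 h2 = ≤-trans (halve′ m 3 h2) (≤-by 3 _ (13 + 4 * j) (eq j))
  where
  eq : ∀ j → 3 + (13 + 4 * j) ≡ 14 + 4 * j + 2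
  eq = solve-∀
oddBound-stepB (suc (suc (suc (suc j)))) m 3 h1 h2 = ≤-trans (halve′ m 6 h2) (≤-by 6 _ (11 + 4 * j) (eq j))
  where
  eq : ∀ j → 6 + (11 + 4 * j) ≡ 14 + 4 * j + 3
  eq = solve-∀
oddBound-stepB (suc (suc (suc (suc j)))) m (suc (suc (suc (suc Δ)))) h1 h2 =
  ≤-trans h1 (≤-by _ _ Δ (eq j Δ))
  where
  eq : ∀ j Δ → 14 + 4 * suc j + Δ ≡ 14 + 4 * j + (4 + Δ)
  eq = solve-∀

-- The even analogues; there the bound is linear from the start.
evenBound-stepA : ∀ k m Δ → m ≤ evenBound (suc k) → m + m ≤ (suc k + suc k) * Δ →
                  m ≤ evenBound k + (1 + Δ)
evenBound-stepA zero m Δ h1 h2 = ≤0⇒≤ _ h1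
evenBound-stepA (suc j) m zero h1 h2 = ≤0⇒≤ _ (Δ0⇒noPairs m (suc (suc j) + suc (suc j)) h2)
evenBound-stepA (suc j) m (suc Δ) h1 h2 = ≤-trans h1 (≤-by _ _ Δ (eq j Δ))
  where
  eq : ∀ j Δ → (suc j + suc j) + Δ ≡ (j + j) + (1 + suc Δ)
  eq = solve-∀

evenBound-stepB : ∀ k m Δ → m ≤ evenBound (suc k) → m + m ≤ suc Δ * Δ → m ≤ evenBound k + Δ
evenBound-stepB zero m Δ h1 h2 = ≤0⇒≤ _ h1
evenBound-stepB (suc j) m zero h1 h2 = ≤0⇒≤ _ (halve m 0 (m≤n⇒m≤1+n h2))
evenBound-stepB (suc j) m (suc zero) h1 h2 = ≤-trans (halve m 1 (m≤n⇒m≤1+n h2)) (m≤n+m 1 (j + j))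
evenBound-stepB (suc j) m (suc (suc Δ)) h1 h2 = ≤-trans h1 (≤-by _ _ Δ (eq j Δ))
  where
  eq : ∀ j Δ → (suc j + suc j) + Δ ≡ (j + j) + suc (suc Δ)
  eq = solve-∀

dropPairA : ∀ {m s d Δ} T → m ≡ s + (d + Δ) → 1 ≤ d → m ≤ T + (1 + Δ) → s ≤ T
dropPairA {m} {s} {d} {Δ} T e 1≤d h = +-cancelʳ-≤ (1 + Δ) s T
  (≤-trans (+-monoʳ-≤ s (+-monoˡ-≤ Δ 1≤d)) (≤-trans (≤-reflexive (sym e)) h))

dropPairB : ∀ {m s d Δ} T → m ≡ s + (d + Δ) → m ≤ T + Δ → s ≤ T
dropPairB {m} {s} {d} {Δ} T e h = +-cancelʳ-≤ Δ s T
  (≤-trans (+-monoʳ-≤ s (m≤n+m Δ d)) (≤-trans (≤-reflexive (sym e)) h))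

oddStep : ∀ k {m s d Δ} → m ≡ s + (d + Δ) → m ≤ oddBound (suc k) →
          PairCert (suc (suc k + suc k)) m d Δ → s ≤ oddBound k
oddStep k {m} {d = d} {Δ} e m≤ (inj₁ (1≤d , h)) =
  dropPairA {d = d} (oddBound k) e 1≤d (oddBound-stepA k m Δ m≤ h)
oddStep k {m} {d = d} {Δ} e m≤ (inj₂ h) = dropPairB {d = d} (oddBound k) e (oddBound-stepB k m Δ m≤ h)

evenStep : ∀ k {m s d Δ} → m ≡ s + (d + Δ) → m ≤ evenBound (suc k) →
           PairCert (suc k + suc k) m d Δ → s ≤ evenBound k
evenStep k {m} {d = d} {Δ} e m≤ (inj₁ (1≤d , h)) =
  dropPairA {d = d} (evenBound k) e 1≤d (evenBound-stepA k m Δ m≤ h)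
evenStep k {m} {d = d} {Δ} e m≤ (inj₂ h) = dropPairB {d = d} (evenBound k) e (evenBound-stepB k m Δ m≤ h)

card-minus-two-even : ∀ {a} k → a + 1 + 1 ≡ suc k + suc k → a ≡ k + k
card-minus-two-even {a} k e = +-cancelʳ-≡ 1 _ _ (+-cancelʳ-≡ 1 _ _ (trans e (eq k)))
  where
  eq : ∀ k → suc k + suc k ≡ k + k + 1 + 1
  eq = solve-∀

card-minus-two-odd : ∀ {a} k → a + 1 + 1 ≡ suc (suc k + suc k) → a ≡ suc (k + k)
card-minus-two-odd {a} k e = +-cancelʳ-≡ 1 _ _ (+-cancelʳ-≡ 1 _ _ (trans e (eq k)))
  where
  eq : ∀ k → suc (suc k + suc k) ≡ suc (k + k) + 1 + 1
  eq = solve-∀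

card-minus-one : ∀ {a b} → a + 1 ≡ suc b → a ≡ b
card-minus-one {a} e = suc-injective (trans (+-comm 1 a) e)

-- If u is forbidden with all 2k+2 other vertices (Δ ≥ 2k+2), deleting u leaves few
-- enough forbidden pairs for a perfect matching of the rest.
oddBound-isolated : ∀ k {m s Δ} → m ≡ s + Δ → suc k + suc k ≤ Δ → m ≤ oddBound (suc k) →
                    s ≤ evenBound (suc k)
oddBound-isolated k {m} {s} {Δ} e lo h = +-cancelʳ-≤ (suc k + suc k) s (k + k)
  (≤-trans (+-monoʳ-≤ s lo) (≤-trans (≤-reflexive (sym e)) (≤-trans h (bound k))))
  where
  bound : ∀ k → oddBound (suc k) ≤ (k + k) + (suc k + suc k)
  bound 0 = ≤-refl
  bound 1 = m≤m+n 5 1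
  bound 2 = m≤m+n 9 1
  bound 3 = ≤-refl
  bound (suc (suc (suc (suc j)))) = ≤-reflexive (eq j)
    where
    eq : ∀ j → 14 + 4 * suc j ≡ (4 + j + (4 + j)) + (suc (4 + j) + suc (4 + j))
    eq = solve-∀

-- Counting inside a vertex set S for a symmetric irreflexive relation R (later: the
-- forbidden pairs, or the edges of a preclusion set).
module Counting {n : ℕ} (R : Fin n → Fin n → Bool)
                (R-sym : ∀ i j → R i j ≡ R j i) (R-irrefl : ∀ i → R i i ≡ false) where

  VertexSet : Set
  VertexSet = Fin n → Bool

  everything : VertexSet
  everything _ = true

  card : VertexSet → ℕ
  card S = sumFin λ x → b2n (S x)

  deg : VertexSet → Fin n → ℕ
  deg S w = sumFin λ x → b2n (S x) * b2n (R w x)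

  degSum : VertexSet → ℕ
  degSum S = sumFin λ w → b2n (S w) * deg S w

  pairIn : VertexSet → Fin n → Fin n → ℕ
  pairIn S i j = b2n (S i) * (b2n (S j) * b2n (R i j))

  edges : VertexSet → ℕ
  edges S = sumFin λ i → sumFin λ j → b2n (toℕ i <ᵇ toℕ j) * pairIn S i j

  infixl 6 _∖_
  _∖_ : VertexSet → Fin n → VertexSet
  (S ∖ u) x = S x ∧ not (eqᵇ x u)

  ∖-elim : ∀ S u x → (S ∖ u) x ≡ true → (S x ≡ true) × (x ≢ u)
  ∖-elim S u x e with S x | x ≟ u
  ... | true | no x≢u = refl , x≢u

  ∖-intro : ∀ S u x → S x ≡ true → x ≢ u → (S ∖ u) x ≡ true
  ∖-intro S u x Sx x≢u rewrite Sx | eqᵇ-≢ x≢u = refl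

  ∖-self : ∀ S u → (S ∖ u) u ≡ false
  ∖-self S u rewrite eqᵇ-refl u = Boolᵖ.∧-zeroʳ (S u)

  ∖-outside : ∀ S u x → S x ≡ false → (S ∖ u) x ≡ false
  ∖-outside S u x Sx rewrite Sx = refl

  ∖-split : ∀ S u → S u ≡ true → ∀ x → b2n (S x) ≡ b2n ((S ∖ u) x) + b2n (eqᵇ x u)
  ∖-split S u Su x with x ≟ u
  ... | yes refl rewrite Su = refl
  ... | no _ with S x
  ...   | true  = refl
  ...   | false = refl

  card-∖ : ∀ S u → S u ≡ true → card S ≡ card (S ∖ u) + 1
  card-∖ S u Su = begin
    card S                                              ≡⟨ sumFin-cong (∖-split S u Su) ⟩
    sumFin (λ x → b2n ((S ∖ u) x) + b2n (eqᵇ x u))      ≡⟨ sumFin-+ {n} _ _ ⟩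
    card (S ∖ u) + sumFin (λ x → b2n (eqᵇ x u))         ≡⟨ cong (card (S ∖ u) +_) (sumFin-point u) ⟩
    card (S ∖ u) + 1                                    ∎

  deg-∖ : ∀ S u → S u ≡ true → ∀ w → deg S w ≡ deg (S ∖ u) w + b2n (R w u)
  deg-∖ S u Su w = begin
    deg S w
      ≡⟨ sumFin-cong (λ x → trans (cong (_* b2n (R w x)) (∖-split S u Su x))
                                  (*-distribʳ-+ (b2n (R w x)) (b2n ((S ∖ u) x)) (b2n (eqᵇ x u)))) ⟩
    sumFin (λ x → b2n ((S ∖ u) x) * b2n (R w x) + b2n (eqᵇ x u) * b2n (R w x))
      ≡⟨ sumFin-+ {n} _ _ ⟩
    deg (S ∖ u) w + sumFin (λ x → b2n (eqᵇ x u) * b2n (R w x))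
      ≡⟨ cong (deg (S ∖ u) w +_) (sumFin-pick u (λ x → b2n (R w x))) ⟩
    deg (S ∖ u) w + b2n (R w u) ∎

  deg-∖-self : ∀ S u → S u ≡ true → deg S u ≡ deg (S ∖ u) u
  deg-∖-self S u Su = begin
    deg S u                      ≡⟨ deg-∖ S u Su u ⟩
    deg (S ∖ u) u + b2n (R u u)  ≡⟨ cong (λ b → deg (S ∖ u) u + b2n b) (R-irrefl u) ⟩
    deg (S ∖ u) u + 0            ≡⟨ +-identityʳ _ ⟩
    deg (S ∖ u) u                ∎

  deg-flip : ∀ S u → sumFin (λ w → b2n (S w) * b2n (R w u)) ≡ deg S u
  deg-flip S u = sumFin-cong (λ w → cong (λ b → b2n (S w) * b2n b) (R-sym w u))

  degSum-∖ : ∀ S u → S u ≡ true → degSum S ≡ degSum (S ∖ u) + (deg S u + deg S u)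
  degSum-∖ S u Su = begin
    degSum S
      ≡⟨ sumFin-cong (λ w → trans (cong (_* deg S w) (∖-split S u Su w))
                                  (*-distribʳ-+ (deg S w) (b2n (S′ w)) (b2n (eqᵇ w u)))) ⟩
    sumFin (λ w → b2n (S′ w) * deg S w + b2n (eqᵇ w u) * deg S w)
      ≡⟨ sumFin-+ {n} _ _ ⟩
    sumFin (λ w → b2n (S′ w) * deg S w) + sumFin (λ w → b2n (eqᵇ w u) * deg S w)
      ≡⟨ cong₂ _+_ (sumFin-cong (λ w → trans (cong (b2n (S′ w) *_) (deg-∖ S u Su w))
                                             (*-distribˡ-+ (b2n (S′ w)) (deg S′ w) (b2n (R w u)))))
                   (sumFin-pick u (deg S)) ⟩
    sumFin (λ w → b2n (S′ w) * deg S′ w + b2n (S′ w) * b2n (R w u)) + deg S u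
      ≡⟨ cong (_+ deg S u) (sumFin-+ {n} _ _) ⟩
    (degSum S′ + sumFin (λ w → b2n (S′ w) * b2n (R w u))) + deg S u
      ≡⟨ cong (λ z → (degSum S′ + z) + deg S u) (trans (deg-flip S′ u) (sym (deg-∖-self S u Su))) ⟩
    (degSum S′ + deg S u) + deg S u
      ≡⟨ +-assoc (degSum S′) _ _ ⟩
    degSum S′ + (deg S u + deg S u) ∎
    where
    S′ = S ∖ u

  pairIn-sym : ∀ S i j → pairIn S i j ≡ pairIn S j i
  pairIn-sym S i j = begin
    b2n (S i) * (b2n (S j) * b2n (R i j)) ≡⟨ sym (*-assoc (b2n (S i)) _ _) ⟩
    (b2n (S i) * b2n (S j)) * b2n (R i j) ≡⟨ cong₂ _*_ (*-comm (b2n (S i)) _) (cong b2n (R-sym i j)) ⟩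
    (b2n (S j) * b2n (S i)) * b2n (R j i) ≡⟨ *-assoc (b2n (S j)) _ _ ⟩
    b2n (S j) * (b2n (S i) * b2n (R j i)) ∎

  pairIn-split : ∀ S i j →
    pairIn S i j ≡ b2n (toℕ i <ᵇ toℕ j) * pairIn S i j + b2n (toℕ j <ᵇ toℕ i) * pairIn S i j
  pairIn-split S i j with i ≟ j
  ... | yes refl rewrite R-irrefl i | *-zeroʳ (b2n (S i)) | *-zeroʳ (b2n (S i))
                       | *-zeroʳ (b2n (toℕ i <ᵇ toℕ i)) = refl
  ... | no i≢j = sym (trans (sym (*-distribʳ-+ (pairIn S i j) (b2n (toℕ i <ᵇ toℕ j)) _))
                     (trans (cong (_* pairIn S i j) (<ᵇ-trichotomy (toℕ i) (toℕ j) (i≢j ∘ toℕ-injective)))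
                            (*-identityˡ _)))
    where
    <ᵇ-trichotomy : ∀ a b → a ≢ b → b2n (a <ᵇ b) + b2n (b <ᵇ a) ≡ 1
    <ᵇ-trichotomy zero    zero    a≢b = ⊥-elim (a≢b refl)
    <ᵇ-trichotomy zero    (suc b) a≢b = refl
    <ᵇ-trichotomy (suc a) zero    a≢b = refl
    <ᵇ-trichotomy (suc a) (suc b) a≢b = <ᵇ-trichotomy a b (λ e → a≢b (cong suc e))

  handshake : ∀ S → degSum S ≡ edges S + edges S
  handshake S = begin
    degSum S
      ≡⟨ sumFin-cong {n} (λ w → sym (sumFin-*ˡ {n} (b2n (S w)) _)) ⟩
    sumFin (λ i → sumFin (λ j → pairIn S i j))
      ≡⟨ sumFin-cong {n} (λ i → trans (sumFin-cong {n} (pairIn-split S i)) (sumFin-+ {n} _ _)) ⟩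
    sumFin (λ i → below i + sumFin (λ j → b2n (toℕ j <ᵇ toℕ i) * pairIn S i j))
      ≡⟨ sumFin-+ {n} _ _ ⟩
    edges S + sumFin (λ i → sumFin (λ j → b2n (toℕ j <ᵇ toℕ i) * pairIn S i j))
      ≡⟨ cong (edges S +_) (trans (sumFin-comm {n} _)
           (sumFin-cong {n} (λ j → sumFin-cong {n} (λ i → cong (b2n (toℕ j <ᵇ toℕ i) *_) (pairIn-sym S i j))))) ⟩
    edges S + edges S ∎
    where
    below : Fin n → ℕ
    below i = sumFin (λ j → b2n (toℕ i <ᵇ toℕ j) * pairIn S i j)

  edges-∖ : ∀ S u → S u ≡ true → edges S ≡ edges (S ∖ u) + deg S u
  edges-∖ S u Su = halves (begin
    edges S + edges S                                   ≡⟨ sym (handshake S) ⟩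
    degSum S                                            ≡⟨ degSum-∖ S u Su ⟩
    degSum (S ∖ u) + (deg S u + deg S u)                ≡⟨ cong (_+ (deg S u + deg S u)) (handshake (S ∖ u)) ⟩
    (edges (S ∖ u) + edges (S ∖ u)) + (deg S u + deg S u) ≡⟨ regroup (edges (S ∖ u)) (deg S u) ⟩
    (edges (S ∖ u) + deg S u) + (edges (S ∖ u) + deg S u) ∎)
    where
    halves : ∀ {a b} → a + a ≡ b + b → a ≡ b
    halves {a} {b} e = trans (n≡⌊n+n/2⌋ a) (trans (cong ⌊_/2⌋ e) (sym (n≡⌊n+n/2⌋ b)))
    regroup : ∀ a b → (a + a) + (b + b) ≡ (a + b) + (a + b)
    regroup = solve-∀

  NonNeighbour : VertexSet → Fin n → Fin n → Set
  NonNeighbour S u v = (S v ≡ true) × (v ≢ u) × (R u v ≡ false)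

  card-∖∖ : ∀ S u v → S u ≡ true → NonNeighbour S u v → card S ≡ card (S ∖ u ∖ v) + 1 + 1
  card-∖∖ S u v Su (Sv , v≢u , _) =
    trans (card-∖ S u Su) (cong (_+ 1) (card-∖ (S ∖ u) v (∖-intro S u v Sv v≢u)))

  edges-∖∖ : ∀ S u v → S u ≡ true → NonNeighbour S u v →
             edges S ≡ edges (S ∖ u ∖ v) + (deg S v + deg S u)
  edges-∖∖ S u v Su (Sv , v≢u , Ruv) = begin
    edges S                                              ≡⟨ edges-∖ S u Su ⟩
    edges (S ∖ u) + deg S u                              ≡⟨ cong (_+ deg S u) (edges-∖ (S ∖ u) v (∖-intro S u v Sv v≢u)) ⟩
    (edges (S ∖ u ∖ v) + deg (S ∖ u) v) + deg S u        ≡⟨ cong (λ z → (edges (S ∖ u ∖ v) + z) + deg S u) degv ⟩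
    (edges (S ∖ u ∖ v) + deg S v) + deg S u              ≡⟨ +-assoc (edges (S ∖ u ∖ v)) _ _ ⟩
    edges (S ∖ u ∖ v) + (deg S v + deg S u)              ∎
    where
    degv : deg (S ∖ u) v ≡ deg S v
    degv = sym (begin
      deg S v                      ≡⟨ deg-∖ S u Su v ⟩
      deg (S ∖ u) v + b2n (R v u)  ≡⟨ cong (λ b → deg (S ∖ u) v + b2n b) (trans (R-sym v u) Ruv) ⟩
      deg (S ∖ u) v + 0            ≡⟨ +-identityʳ _ ⟩
      deg (S ∖ u) v                ∎)

  deg≤edges : ∀ S u → S u ≡ true → deg S u ≤ edges S
  deg≤edges S u Su = ≤-trans (m≤n+m (deg S u) (edges (S ∖ u))) (≤-reflexive (sym (edges-∖ S u Su)))

  IsMaxDeg : VertexSet → Fin n → Set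
  IsMaxDeg S u = ∀ w → S w ≡ true → deg S w ≤ deg S u

  twiceEdges≤ : ∀ S u → IsMaxDeg S u → edges S + edges S ≤ card S * deg S u
  twiceEdges≤ S u umax =
    ≤-trans (≤-reflexive (sym (handshake S))) (≤-trans (sumFin-mono termwise) (≤-reflexive collect))
    where
    Δ = deg S u
    collect : sumFin (λ w → b2n (S w) * Δ) ≡ card S * Δ
    collect = begin
      sumFin (λ w → b2n (S w) * Δ)  ≡⟨ sumFin-cong (λ w → *-comm (b2n (S w)) Δ) ⟩
      sumFin (λ w → Δ * b2n (S w))  ≡⟨ sumFin-*ˡ {n} Δ _ ⟩
      Δ * card S                    ≡⟨ *-comm Δ (card S) ⟩
      card S * Δ                    ∎
    termwise : ∀ w → b2n (S w) * deg S w ≤ b2n (S w) * Δ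
    termwise w with S w in Sw
    ... | true  = *-monoʳ-≤ 1 (umax w Sw)
    ... | false = z≤n

  -- If every non-neighbour of the maximum-degree vertex u is isolated, each pair meets u
  -- or one of its Δ neighbours, so the degree sum is at most Δ + Δ·Δ.
  twiceEdges≤-star : ∀ S u → S u ≡ true → IsMaxDeg S u →
    (∀ w → NonNeighbour S u w → deg S w ≡ 0) → edges S + edges S ≤ suc (deg S u) * deg S u
  twiceEdges≤-star S u Su umax isolated =
    ≤-trans (≤-reflexive (sym (handshake S))) (≤-trans (sumFin-mono termwise) (≤-reflexive collect))
    where
    Δ = deg S u
    collect : sumFin (λ w → Δ * (b2n (eqᵇ w u) + b2n (S w) * b2n (R u w))) ≡ suc Δ * Δ
    collect = begin
      sumFin (λ w → Δ * (b2n (eqᵇ w u) + b2n (S w) * b2n (R u w)))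
        ≡⟨ sumFin-*ˡ {n} Δ _ ⟩
      Δ * sumFin (λ w → b2n (eqᵇ w u) + b2n (S w) * b2n (R u w))
        ≡⟨ cong (Δ *_) (trans (sumFin-+ {n} _ _) (cong (_+ Δ) (sumFin-point u))) ⟩
      Δ * suc Δ    ≡⟨ *-comm Δ (suc Δ) ⟩
      suc Δ * Δ    ∎
    termwise : ∀ w → b2n (S w) * deg S w ≤ Δ * (b2n (eqᵇ w u) + b2n (S w) * b2n (R u w))
    termwise w with S w in Sw
    ... | false = z≤n
    ... | true with w ≟ u
    ...   | yes refl rewrite R-irrefl w = ≤-reflexive (trans (+-identityʳ _) (sym (*-identityʳ _)))
    ...   | no w≢u with R u w in Ruw
    ...     | true  = ≤-trans (≤-reflexive (+-identityʳ _)) (≤-trans (umax w Sw) (≤-reflexive (sym (*-identityʳ _))))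
    ...     | false rewrite isolated w (Sw , w≢u , Ruw) = z≤n

  nonNeighbour? : ∀ S u → Dec (Σ (Fin n) (NonNeighbour S u))
  nonNeighbour? S u = any? (λ v → (S v Boolᵖ.≟ true) ×-dec ¬? (v ≟ u) ×-dec (R u v Boolᵖ.≟ false))

  activeNonNeighbour? : ∀ S u → Dec (Σ (Fin n) λ v → NonNeighbour S u v × 1 ≤ deg S v)
  activeNonNeighbour? S u = any? (λ v → ((S v Boolᵖ.≟ true) ×-dec ¬? (v ≟ u) ×-dec (R u v Boolᵖ.≟ false))
                                          ×-dec (1 ≤? deg S v))

  -- The partner of the maximum-degree vertex u: a non-neighbour, of positive degree if
  -- there is one; PairCert records which case occurred.
  partner : ∀ S u → S u ≡ true → IsMaxDeg S u → Σ (Fin n) (NonNeighbour S u) →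
            Σ (Fin n) λ v → NonNeighbour S u v × PairCert (card S) (edges S) (deg S v) (deg S u)
  partner S u Su umax (v , v-non) with activeNonNeighbour? S u
  ... | yes (v′ , v′-non , 1≤d) = v′ , v′-non , inj₁ (1≤d , twiceEdges≤ S u umax)
  ... | no noActive = v , v-non , inj₂ (twiceEdges≤-star S u Su umax isolated)
    where
    isolated : ∀ w → NonNeighbour S u w → deg S w ≡ 0
    isolated w w-non with 1 ≤? deg S w
    ... | yes 1≤d = ⊥-elim (noActive (w , w-non , 1≤d))
    ... | no 1≰d = n≤0⇒n≡0 (≤-pred (≰⇒> 1≰d))

  nonNeighbour-exists : ∀ S u → deg S u < card (S ∖ u) → Σ (Fin n) (NonNeighbour S u)
  nonNeighbour-exists S u lt with sumFin-< (λ x → b2n (S x) * b2n (R u x)) (λ x → b2n ((S ∖ u) x)) lt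
  ... | x , q with S x in Sx | x ≟ u | R u x in Rux
  ...   | true  | no x≢u | false = x , Sx , x≢u , Rux
  ...   | true  | no _   | true  = ⊥-elim (<-irrefl refl q)
  ...   | true  | yes refl | _   = ⊥-elim (<-irrefl refl (≤-trans q z≤n))
  ...   | false | _      | _     = ⊥-elim (<-irrefl refl (≤-trans q z≤n))

  card≤deg : ∀ S u → (∀ x → S x ≡ true → x ≢ u → R u x ≡ true) → card (S ∖ u) ≤ deg S u
  card≤deg S u all = sumFin-mono termwise
    where
    termwise : ∀ x → b2n ((S ∖ u) x) ≤ b2n (S x) * b2n (R u x)
    termwise x with S x in Sx | x ≟ u
    ... | false | _        = z≤n
    ... | true  | yes refl = z≤n
    ... | true  | no x≢u rewrite all x Sx x≢u = ≤-refl

  member : ∀ S → 0 < card S → Σ (Fin n) λ x → S x ≡ true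
  member S lt with sumFin-< (λ _ → 0) (λ x → b2n (S x)) (≤-trans (s≤s (≤-reflexive (sumFin-zero {n} (λ _ → 0) (λ _ → refl)))) lt)
  ... | x , q with S x in Sx
  ...   | true  = x , Sx
  ...   | false = ⊥-elim (<-irrefl refl (≤-trans q z≤n))

  member-card : ∀ S w → S w ≡ true → 1 ≤ card S
  member-card S w Sw = ≤-trans (≤-reflexive (cong b2n (sym Sw))) (sumFin-term _ w)

  -- Weighting members by 1 + degree and non-members by 0, a heaviest vertex is a
  -- member of maximum degree.
  weight : VertexSet → Fin n → ℕ
  weight S w = b2n (S w) * suc (deg S w)

  weight-member : ∀ S w → S w ≡ true → weight S w ≡ suc (deg S w)
  weight-member S w Sw = trans (cong (λ b → b2n b * suc (deg S w)) Sw) (+-identityʳ _)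

  maxDegVertex : ∀ S → Σ (Fin n) (λ x → S x ≡ true) → Σ (Fin n) λ u → (S u ≡ true) × IsMaxDeg S u
  maxDegVertex S (x₀ , Sx₀) with argmax x₀ (weight S)
  ... | u , heaviest with S u in Su
  ...   | true  = u , Su , λ w Sw →
            ≤-pred (≤-trans (≤-reflexive (sym (weight-member S w Sw))) (≤-trans (heaviest w) (≤-reflexive (+-identityʳ _))))
  ...   | false = ⊥-elim (<-irrefl refl
            (≤-trans (s≤s z≤n) (≤-trans (≤-reflexive (sym (weight-member S x₀ Sx₀))) (heaviest x₀))))

  record MatchingIn (S : VertexSet) : Set where
    field
      pairs     : Fin n → Fin n → Bool
      pairs-sym : ∀ i j → pairs i j ≡ pairs j i
      avoids    : ∀ i j → pairs i j ≡ true → (i ≢ j) × (R i j ≡ false)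
      inside    : ∀ i j → pairs i j ≡ true → S i ≡ true
  open MatchingIn public

  covered : ∀ {S} → MatchingIn S → Fin n → ℕ
  covered M w = sumFin λ x → b2n (pairs M w x)

  Perfect : VertexSet → Set
  Perfect S = Σ (MatchingIn S) λ M → ∀ w → S w ≡ true → covered M w ≡ 1

  NearPerfect : VertexSet → Set
  NearPerfect S = Σ (MatchingIn S) λ M → Σ (Fin n) λ z →
    (S z ≡ true) × (covered M z ≡ 0) × (∀ w → S w ≡ true → w ≢ z → covered M w ≡ 1)

  noPairs : ∀ S → MatchingIn S
  noPairs S = record { pairs = λ _ _ → false ; pairs-sym = λ _ _ → refl
                     ; avoids = λ _ _ () ; inside = λ _ _ () }

  row-outside : ∀ {S} (M : MatchingIn S) w → S w ≡ false → ∀ x → pairs M w x ≡ false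
  row-outside M w Sw x with pairs M w x in e
  ... | false = refl
  ... | true  with trans (sym (inside M w x e)) Sw
  ...   | ()

  covered-row : ∀ {S} (M : MatchingIn S) w t → (∀ x → pairs M w x ≡ eqᵇ x t) → covered M w ≡ 1
  covered-row M w t row = trans (sumFin-cong (λ x → cong b2n (row x))) (sumFin-point t)

  covered-outside : ∀ {S} (M : MatchingIn S) w → S w ≡ false → covered M w ≡ 0
  covered-outside M w Sw = sumFin-zero _ (λ x → cong b2n (row-outside M w Sw x))

  widen : ∀ S u → MatchingIn (S ∖ u) → MatchingIn S
  widen S u M = record { pairs = pairs M ; pairs-sym = pairs-sym M ; avoids = avoids M
                       ; inside = λ i j e → proj₁ (∖-elim S u i (inside M i j e)) }

  nearPerfect-leaving : ∀ S u → S u ≡ true → Perfect (S ∖ u) → NearPerfect S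
  nearPerfect-leaving S u Su (M , perfect) =
    widen S u M , u , Su , covered-outside M u (∖-self S u) ,
    λ w Sw w≢u → perfect w (∖-intro S u w Sw w≢u)

  thePair : Fin n → Fin n → Fin n → Fin n → Bool
  thePair u v i j = (eqᵇ i u ∧ eqᵇ j v) ∨ (eqᵇ i v ∧ eqᵇ j u)

  thePair-elim : ∀ u v i j → thePair u v i j ≡ true → ((i ≡ u) × (j ≡ v)) ⊎ ((i ≡ v) × (j ≡ u))
  thePair-elim u v i j e with eqᵇ i u in iu | eqᵇ j v in jv | eqᵇ i v in iv | eqᵇ j u in ju
  ... | true | true | _    | _    = inj₁ (eqᵇ-true iu , eqᵇ-true jv)
  ... | true | false | true | true = inj₂ (eqᵇ-true iv , eqᵇ-true ju)
  ... | false | _   | true | true = inj₂ (eqᵇ-true iv , eqᵇ-true ju)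

  withPair : ∀ S u v → S u ≡ true → NonNeighbour S u v → MatchingIn (S ∖ u ∖ v) → MatchingIn S
  withPair S u v Su (Sv , v≢u , Ruv) M = record
    { pairs     = λ i j → pairs M i j ∨ thePair u v i j
    ; pairs-sym = λ i j → cong₂ _∨_ (pairs-sym M i j) (thePair-sym i j)
    ; avoids    = ok
    ; inside    = in-S }
    where
    thePair-sym : ∀ i j → thePair u v i j ≡ thePair u v j i
    thePair-sym i j = trans (cong₂ _∨_ (Boolᵖ.∧-comm (eqᵇ i u) _) (Boolᵖ.∧-comm (eqᵇ i v) _))
                            (Boolᵖ.∨-comm (eqᵇ j v ∧ eqᵇ i u) (eqᵇ j u ∧ eqᵇ i v))
    ok : ∀ i j → pairs M i j ∨ thePair u v i j ≡ true → (i ≢ j) × (R i j ≡ false)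
    ok i j e with pairs M i j in Mij
    ... | true = avoids M i j Mij
    ... | false with thePair-elim u v i j e
    ...   | inj₁ (refl , refl) = v≢u ∘ sym , Ruv
    ...   | inj₂ (refl , refl) = v≢u , trans (R-sym v u) Ruv
    in-S : ∀ i j → pairs M i j ∨ thePair u v i j ≡ true → S i ≡ true
    in-S i j e with pairs M i j in Mij
    ... | true = proj₁ (∖-elim S u i (proj₁ (∖-elim (S ∖ u) v i (inside M i j Mij))))
    ... | false with thePair-elim u v i j e
    ...   | inj₁ (refl , refl) = Su
    ...   | inj₂ (refl , refl) = Sv

  module _ S u v (Su : S u ≡ true) (uv : NonNeighbour S u v) (M : MatchingIn (S ∖ u ∖ v)) where
    private
      M⁺ = withPair S u v Su uv M
      v≢u = proj₁ (proj₂ uv)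
      u-out : (S ∖ u ∖ v) u ≡ false
      u-out = ∖-outside (S ∖ u) v u (∖-self S u)

    covered-u : covered M⁺ u ≡ 1
    covered-u = covered-row M⁺ u v row
      where
      row : ∀ x → pairs M u x ∨ thePair u v u x ≡ eqᵇ x v
      row x rewrite row-outside M u u-out x | eqᵇ-refl u | eqᵇ-≢ (v≢u ∘ sym) = Boolᵖ.∨-identityʳ _

    covered-v : covered M⁺ v ≡ 1
    covered-v = covered-row M⁺ v u row
      where
      row : ∀ x → pairs M v x ∨ thePair u v v x ≡ eqᵇ x u
      row x rewrite row-outside M v (∖-self (S ∖ u) v) x | eqᵇ-refl v | eqᵇ-≢ v≢u = refl

    covered-other : ∀ w → w ≢ u → w ≢ v → covered M⁺ w ≡ covered M w
    covered-other w w≢u w≢v = sumFin-cong (λ x → cong b2n (row x))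
      where
      row : ∀ x → pairs M w x ∨ thePair u v w x ≡ pairs M w x
      row x rewrite eqᵇ-≢ w≢u | eqᵇ-≢ w≢v = Boolᵖ.∨-identityʳ _

    covered-member : ∀ w → (w ≢ u → w ≢ v → covered M w ≡ 1) → covered M⁺ w ≡ 1
    covered-member w h = cases (w ≟ u) (w ≟ v)
      where
      cases : Dec (w ≡ u) → Dec (w ≡ v) → covered M⁺ w ≡ 1
      cases (yes refl) _          = covered-u
      cases (no _)     (yes refl) = covered-v
      cases (no w≢u)   (no w≢v)   = trans (covered-other w w≢u w≢v) (h w≢u w≢v)

  ∖∖-intro : ∀ S u v w → S w ≡ true → w ≢ u → w ≢ v → (S ∖ u ∖ v) w ≡ true
  ∖∖-intro S u v w Sw w≢u w≢v = ∖-intro (S ∖ u) v w (∖-intro S u w Sw w≢u) w≢v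

  extendPerfect : ∀ S u v → S u ≡ true → NonNeighbour S u v → Perfect (S ∖ u ∖ v) → Perfect S
  extendPerfect S u v Su uv (M , perfect) =
    withPair S u v Su uv M ,
    λ w Sw → covered-member S u v Su uv M w (λ w≢u w≢v → perfect w (∖∖-intro S u v w Sw w≢u w≢v))

  extendNearPerfect : ∀ S u v → S u ≡ true → NonNeighbour S u v → NearPerfect (S ∖ u ∖ v) → NearPerfect S
  extendNearPerfect S u v Su uv (M , z , Sz , z-free , others) =
    withPair S u v Su uv M , z , proj₁ z∈S∖u ,
    trans (covered-other S u v Su uv M z (proj₂ z∈S∖u) (proj₂ z∈S∖u∖v)) z-free ,
    λ w Sw w≢z → covered-member S u v Su uv M w
                   (λ w≢u w≢v → others w (∖∖-intro S u v w Sw w≢u w≢v) w≢z)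
    where
    z∈S∖u∖v = ∖-elim (S ∖ u) v z Sz
    z∈S∖u = ∖-elim S u z (proj₁ z∈S∖u∖v)

  -- A set of 2k vertices with at most evenBound k forbidden pairs has an R-avoiding
  -- perfect matching: match a maximum-degree vertex u with a suitable non-neighbour
  -- (one exists since deg u ≤ edges < 2k + 1) and recurse on the remaining 2k − 2.
  perfect : ∀ k S → card S ≡ k + k → edges S ≤ evenBound k → Perfect S
  perfect zero S c _ = noPairs S , λ w Sw → ⊥-elim (1+n≰n (≤-trans (member-card S w Sw) (≤-reflexive c)))
  perfect (suc k) S c e with maxDegVertex S (member S (≤-trans (s≤s z≤n) (≤-reflexive (sym c))))
  ... | u , Su , umax with partner S u Su umax (nonNeighbour-exists S u (fewNeighbours u Su))
    where
    fewNeighbours : ∀ u → S u ≡ true → deg S u < card (S ∖ u)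
    fewNeighbours u Su = ≤-trans (s≤s (≤-trans (deg≤edges S u Su) e))
      (≤-reflexive (sym (trans (card-minus-one (trans (sym (card-∖ S u Su)) c)) (+-suc k k))))
  ...   | v , uv , cert = extendPerfect S u v Su uv
          (perfect k (S ∖ u ∖ v) (card-minus-two-even k (trans (sym (card-∖∖ S u v Su uv)) c))
                   (evenStep k (edges-∖∖ S u v Su uv) e (subst (λ N → PairCert N (edges S) (deg S v) (deg S u)) c cert)))

  -- With u of maximum degree: if u has a non-neighbour, match
  -- it with a suitable one and recurse on 2k − 1 vertices; otherwise u is forbidden with
  -- everybody, so leave u out and match the remaining 2k vertices perfectly.
  nearPerfect : ∀ k S → card S ≡ suc (k + k) → edges S ≤ oddBound k → NearPerfect S
  nearPerfect zero S c _ with member S (≤-trans (s≤s z≤n) (≤-reflexive (sym c)))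
  ... | u , Su = noPairs S , u , Su , sumFin-zero {n} _ (λ _ → refl) , λ w Sw w≢u →
        ⊥-elim (1+n≰n (≤-trans (member-card (S ∖ u) w (∖-intro S u w Sw w≢u))
                               (≤-reflexive (card-minus-one (trans (sym (card-∖ S u Su)) c)))))
  nearPerfect (suc k) S c e with maxDegVertex S (member S (≤-trans (s≤s z≤n) (≤-reflexive (sym c))))
  ... | u , Su , umax with nonNeighbour? S u
  ...   | yes nn with partner S u Su umax nn
  ...     | v , uv , cert = extendNearPerfect S u v Su uv
            (nearPerfect k (S ∖ u ∖ v) (card-minus-two-odd k (trans (sym (card-∖∖ S u v Su uv)) c))
                         (oddStep k (edges-∖∖ S u v Su uv) e (subst (λ N → PairCert N (edges S) (deg S v) (deg S u)) c cert)))
  nearPerfect (suc k) S c e | u , Su , umax | no none =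
    nearPerfect-leaving S u Su (perfect (suc k) (S ∖ u) card-rest
      (oddBound-isolated k (edges-∖ S u Su) (≤-trans (≤-reflexive (sym card-rest)) (card≤deg S u related)) e))
    where
    card-rest : card (S ∖ u) ≡ suc k + suc k
    card-rest = card-minus-one (trans (sym (card-∖ S u Su)) c)
    related : ∀ x → S x ≡ true → x ≢ u → R u x ≡ true
    related x Sx x≢u with R u x in Rux
    ... | true  = refl
    ... | false = ⊥-elim (none (x , Sx , x≢u , Rux))

degree : ∀ {n} → Graph n → Fin n → ℕ
degree G w = sumFin λ x → b2n (adj G w x)

Isolated : ∀ {n} → Graph n → Fin n → Set
Isolated G w = ∀ x → adj G w x ≡ false

Edgeless : ∀ {n} → Graph n → Set
Edgeless G = ∀ i j → adj G i j ≡ false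

compAdj-self : ∀ {n} (a : Fin n → Fin n → Bool) i → compAdj a i i ≡ false
compAdj-self a i with i ≟ i
... | yes _  = refl
... | no i≢i = ⊥-elim (i≢i refl)

compAdj-≢ : ∀ {n} (a : Fin n → Fin n → Bool) i j → i ≢ j → compAdj a i j ≡ not (a i j)
compAdj-≢ a i j i≢j with i ≟ j
... | yes i≡j = ⊥-elim (i≢j i≡j)
... | no _    = refl

-- Each vertex w ≠ x is adjacent to x in exactly one of G and its complement.
degree-complement : ∀ {n} (G : Graph n) w → degree G w + degree (complement G) w + 1 ≡ n
degree-complement {n} G w = begin
  degree G w + degree (complement G) w + 1
    ≡⟨ cong₂ _+_ (sym (sumFin-+ {n} _ _)) (sym (sumFin-point w)) ⟩
  sumFin (λ x → b2n (adj G w x) + b2n (compAdj (adj G) w x)) + sumFin (λ x → b2n (eqᵇ x w))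
    ≡⟨ sym (sumFin-+ {n} _ _) ⟩
  sumFin (λ x → b2n (adj G w x) + b2n (compAdj (adj G) w x) + b2n (eqᵇ x w))
    ≡⟨ sumFin-cong one ⟩
  sumFin {n} (λ _ → 1)
    ≡⟨ sumFin-ones ⟩
  n ∎
  where
  one : ∀ x → b2n (adj G w x) + b2n (compAdj (adj G) w x) + b2n (eqᵇ x w) ≡ 1
  one x with x ≟ w
  ... | yes refl rewrite adj-irrefl G x | compAdj-self (adj G) x = refl
  ... | no x≢w rewrite compAdj-≢ (adj G) w x (x≢w ∘ sym) = trans (+-identityʳ _) (b2n-not (adj G w x))

complete⇒complement-edgeless : ∀ {n} (G : Graph n) → IsComplete G → Edgeless (complement G)
complete⇒complement-edgeless G cG i j = byCases (i ≟ j)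
  where
  byCases : Dec (i ≡ j) → compAdj (adj G) i j ≡ false
  byCases (yes refl) = compAdj-self (adj G) i
  byCases (no i≢j)   = trans (compAdj-≢ (adj G) i j i≢j) (cong not (cG i j i≢j))

complement-complete⇒edgeless : ∀ {n} (G : Graph n) → IsComplete (complement G) → Edgeless G
complement-complete⇒edgeless G cH i j = byCases (i ≟ j)
  where
  byCases : Dec (i ≡ j) → adj G i j ≡ false
  byCases (yes refl) = adj-irrefl G i
  byCases (no i≢j) with adj G i j in e
  ... | false = refl
  ... | true with trans (sym (cH i j i≢j)) (trans (compAdj-≢ (adj G) i j i≢j) (cong not e))
  ...   | ()

degree-edgeless : ∀ {n} (G : Graph n) → Edgeless G → ∀ w → degree G w ≡ 0
degree-edgeless G none w = sumFin-zero _ (λ x → cong b2n (none w x))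

degree-complete : ∀ {n} (G : Graph n) → IsComplete G → ∀ w → degree G w + 1 ≡ n
degree-complete G cG w = begin
  degree G w + 1                                 ≡⟨ cong (_+ 1) (sym (+-identityʳ _)) ⟩
  degree G w + 0 + 1                             ≡⟨ cong (λ t → degree G w + t + 1) (sym zeroH) ⟩
  degree G w + degree (complement G) w + 1       ≡⟨ degree-complement G w ⟩
  _                                              ∎
  where
  zeroH : degree (complement G) w ≡ 0
  zeroH = degree-edgeless (complement G) (complete⇒complement-edgeless G cG) w

uncovered : ∀ {n} {H : Graph n} (M : EdgeSubset H) w → Isolated H w → degIn M w ≡ 0
uncovered {H = H} M w iso = sumFin-zero _ noEdge
  where
  noEdge : ∀ x → b2n (mem M w x) ≡ 0
  noEdge x with mem M w x in e
  ... | false = refl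
  ... | true with trans (sym (mem-sub M w x e)) (iso x)
  ...   | ()

twoIsolated⇒noMatching : ∀ {n} (H : Graph n) u v → u ≢ v → Isolated H u → Isolated H v →
  ¬ HasPerfectMatching H × ¬ HasAlmostPerfectMatching H
twoIsolated⇒noMatching H u v u≢v iso-u iso-v = noPM , noAPM
  where
  noPM : ¬ HasPerfectMatching H
  noPM (M , perfect) with trans (sym (perfect u)) (uncovered M u iso-u)
  ... | ()
  noAPM : ¬ HasAlmostPerfectMatching H
  noAPM (M , z , _ , others) with z ≟ u
  ... | yes refl with trans (sym (others v (u≢v ∘ sym))) (uncovered M v iso-v)
  ...   | ()
  noAPM (M , z , _ , others) | no z≢u with trans (sym (others u (z≢u ∘ sym))) (uncovered M u iso-u)
  ...   | ()

mem-irrefl : ∀ {n} {G : Graph n} (F : EdgeSubset G) i → mem F i i ≡ false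
mem-irrefl {G = G} F i with mem F i i in e
... | false = refl
... | true with trans (sym (mem-sub F i i e)) (adj-irrefl G i)
...   | ()

module EdgeCount {n} {G : Graph n} (F : EdgeSubset G) = Counting (mem F) (mem-sym F) (mem-irrefl F)

size≡edges : ∀ {n} {G : Graph n} (F : EdgeSubset G) → size F ≡ EdgeCount.edges F (EdgeCount.everything F)
size≡edges F = sumFin-cong (λ i → sumFin-cong (λ j → begin
  b2n ((toℕ i <ᵇ toℕ j) ∧ mem F i j)           ≡⟨ b2n-∧ (toℕ i <ᵇ toℕ j) (mem F i j) ⟩
  b2n (toℕ i <ᵇ toℕ j) * b2n (mem F i j)       ≡⟨ cong (b2n (toℕ i <ᵇ toℕ j) *_) (sym (trans (*-identityˡ _) (*-identityˡ _))) ⟩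
  b2n (toℕ i <ᵇ toℕ j) * (1 * (1 * b2n (mem F i j))) ∎))

touches : ∀ {n} → Fin n → Fin n → Fin n → Bool
touches u v i = eqᵇ i u ∨ eqᵇ i v

incident : ∀ {n} (G : Graph n) → Fin n → Fin n → EdgeSubset G
incident G u v = record
  { mem     = λ i j → adj G i j ∧ (touches u v i ∨ touches u v j)
  ; mem-sym = λ i j → cong₂ _∧_ (adj-sym G i j) (Boolᵖ.∨-comm (touches u v i) _)
  ; mem-sub = λ i j e → proj₁ (∧-elim e) }
  where
  ∧-elim : ∀ {a b} → a ∧ b ≡ true → (a ≡ true) × (b ≡ true)
  ∧-elim {true} {true} _ = refl , refl

touches-u : ∀ {n} (u v : Fin n) → touches u v u ≡ true
touches-u u v rewrite eqᵇ-refl u = refl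

touches-v : ∀ {n} (u v : Fin n) → touches u v v ≡ true
touches-v u v rewrite eqᵇ-refl v = Boolᵖ.∨-zeroʳ _

incident-isolates : ∀ {n} (G : Graph n) u v w → touches u v w ≡ true →
  Isolated (deleteEdges G (incident G u v)) w
incident-isolates G u v w t x rewrite t with adj G w x
... | true  = refl
... | false = refl

incident-precludes : ∀ {n} (G : Graph n) u v → u ≢ v → IsPreclusionSet G (incident G u v)
incident-precludes G u v u≢v = twoIsolated⇒noMatching _ u v u≢v
  (incident-isolates G u v u (touches-u u v)) (incident-isolates G u v v (touches-v u v))

incident-size : ∀ {n} (G : Graph n) u v → u ≢ v →
  size (incident G u v) + b2n (adj G u v) ≡ degree G u + degree G v
incident-size {n} G u v u≢v = begin
  size T + b2n (adj G u v)
    ≡⟨ cong (_+ b2n (adj G u v)) (size≡edges T) ⟩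
  edges everything + b2n (adj G u v)
    ≡⟨ cong (_+ b2n (adj G u v)) (edges-∖ everything u refl) ⟩
  (edges (everything ∖ u) + deg everything u) + b2n (adj G u v)
    ≡⟨ cong (λ z → (z + deg everything u) + b2n (adj G u v)) (edges-∖ (everything ∖ u) v v-in) ⟩
  ((edges rest + deg (everything ∖ u) v) + deg everything u) + b2n (adj G u v)
    ≡⟨ cong (λ z → ((z + deg (everything ∖ u) v) + deg everything u) + b2n (adj G u v)) rest-empty ⟩
  ((0 + deg (everything ∖ u) v) + deg everything u) + b2n (adj G u v)
    ≡⟨ regroup (deg (everything ∖ u) v) (deg everything u) (b2n (adj G u v)) ⟩
  deg everything u + (deg (everything ∖ u) v + b2n (adj G u v))
    ≡⟨ cong (λ z → deg everything u + (deg (everything ∖ u) v + b2n z)) (sym (Tvu)) ⟩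
  deg everything u + (deg (everything ∖ u) v + b2n (mem T v u))
    ≡⟨ cong (deg everything u +_) (sym (deg-∖ everything u refl v)) ⟩
  deg everything u + deg everything v
    ≡⟨ cong₂ _+_ (full-row u (touches-u u v)) (full-row v (touches-v u v)) ⟩
  degree G u + degree G v ∎
  where
  T = incident G u v
  open EdgeCount T
  rest = everything ∖ u ∖ v
  v-in : (everything ∖ u) v ≡ true
  v-in = ∖-intro everything u v refl (u≢v ∘ sym)
  regroup : ∀ a b c → ((0 + a) + b) + c ≡ b + (a + c)
  regroup = solve-∀
  full-row : ∀ w → touches u v w ≡ true → deg everything w ≡ degree G w
  full-row w t = sumFin-cong (λ x → trans (*-identityˡ _)
    (cong b2n (trans (cong (λ b → adj G w x ∧ (b ∨ touches u v x)) t) (Boolᵖ.∧-identityʳ _))))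
  Tvu : mem T v u ≡ adj G u v
  Tvu = trans (cong (λ b → adj G v u ∧ (b ∨ touches u v u)) (touches-v u v))
              (trans (Boolᵖ.∧-identityʳ _) (adj-sym G v u))
  rest-empty : edges rest ≡ 0
  rest-empty = sumFin-zero _ (λ i → sumFin-zero _ (λ j → noPair i j))
    where
    untouched : ∀ w → rest w ≡ true → touches u v w ≡ false
    untouched w e with ∖-elim (everything ∖ u) v w e
    ... | e′ , w≢v with ∖-elim everything u w e′
    ...   | _ , w≢u rewrite eqᵇ-≢ w≢u | eqᵇ-≢ w≢v = refl
    noPair : ∀ i j → b2n (toℕ i <ᵇ toℕ j) * pairIn rest i j ≡ 0
    noPair i j with rest i in ei | rest j in ej
    ... | false | _    = *-zeroʳ (b2n (toℕ i <ᵇ toℕ j))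
    ... | true  | false = *-zeroʳ (b2n (toℕ i <ᵇ toℕ j))
    ... | true  | true rewrite untouched i ei | untouched j ej | Boolᵖ.∧-zeroʳ (adj G i j) =
      *-zeroʳ (b2n (toℕ i <ᵇ toℕ j))

distinctPair : ∀ {n} → 2 ≤ n → Σ (Fin n) λ x → Σ (Fin n) λ y → x ≢ y
distinctPair {suc (suc _)} _         = zero , suc zero , λ ()
distinctPair {suc zero} (s≤s ())

mp-edgeless : ∀ {n} (G : Graph n) → 2 ≤ n → Edgeless G → ∀ {b} → IsMP G b → b ≡ 0
mp-edgeless {n} G 2≤n none (_ , minimal) with distinctPair 2≤n
... | x , y , x≢y = n≤0⇒n≡0 (≤-trans (minimal ∅ (twoIsolated⇒noMatching _ x y x≢y (isolated x) (isolated y)))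
                                      (≤-reflexive size-∅))
  where
  ∅ : EdgeSubset G
  ∅ = record { mem = λ _ _ → false ; mem-sym = λ _ _ → refl ; mem-sub = λ _ _ () }
  isolated : ∀ w → Isolated (deleteEdges G ∅) w
  isolated w z rewrite none w z = refl
  size-∅ : size ∅ ≡ 0
  size-∅ = sumFin-zero {n} _ (λ i → sumFin-zero {n} _ (λ j → cong b2n (Boolᵖ.∧-zeroʳ (toℕ i <ᵇ toℕ j))))

-- Deleting at most oddBound k edges from the complete graph on 2k+1 vertices leaves an
-- almost-perfect matching: the forbidden pairs are the deleted edges.
complete-keepsAPM : ∀ {n} (G : Graph n) → IsComplete G → ∀ k → n ≡ suc (k + k) →
  (F : EdgeSubset G) → size F ≤ oddBound k → HasAlmostPerfectMatching (deleteEdges G F)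
complete-keepsAPM {n} G cG k n≡ F small
  with nearPerfect k everything (trans sumFin-ones n≡) (≤-trans (≤-reflexive (sym (size≡edges F))) small)
  where open EdgeCount F
... | M , z , _ , z-free , others =
  record { mem = pairs M ; mem-sym = pairs-sym M ; mem-sub = kept } , z , z-free , λ w w≢z → others w refl w≢z
  where
  open EdgeCount F
  kept : ∀ i j → pairs M i j ≡ true → adj G i j ∧ not (mem F i j) ≡ true
  kept i j e with avoids M i j e
  ... | i≢j , notDeleted rewrite cG i j i≢j | notDeleted = refl

oddBound-large : ∀ j → oddBound (4 + j) + 4 ≡ suc ((4 + j) + (4 + j)) + suc ((4 + j) + (4 + j))
oddBound-large j = eq j
  where
  eq : ∀ j → 14 + 4 * j + 4 ≡ suc ((4 + j) + (4 + j)) + suc ((4 + j) + (4 + j))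
  eq = solve-∀

-- The complete graph on an odd number n ≥ 9 of vertices has mp = 2n − 3: isolating two
-- vertices costs 2n − 3 edges, and deleting fewer keeps an almost-perfect matching.
mp-complete : ∀ {n} (G : Graph n) → IsComplete G → ∀ j → n ≡ suc ((4 + j) + (4 + j)) →
  ∀ {a} → IsMP G a → a + 3 ≡ n + n
mp-complete {n} G cG j n≡ {a} ((F , (_ , noAPM) , size≡a) , minimal)
  with distinctPair (subst (2 ≤_) (sym n≡) (s≤s (s≤s z≤n)))
... | u , v , u≢v = ≤-antisym upper lower
  where
  -- the edges at two vertices number (n − 1) + (n − 1) − 1
  incident-count : size (incident G u v) + 3 ≡ n + n
  incident-count = begin
    size (incident G u v) + 3                            ≡⟨ sym (+-assoc (size (incident G u v)) 1 2) ⟩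
    size (incident G u v) + b2n true + 2                 ≡⟨ cong (λ b → size (incident G u v) + b2n b + 2) (sym (cG u v u≢v)) ⟩
    size (incident G u v) + b2n (adj G u v) + 2          ≡⟨ cong (_+ 2) (incident-size G u v u≢v) ⟩
    degree G u + degree G v + 2                          ≡⟨ regroup (degree G u) (degree G v) ⟩
    (degree G u + 1) + (degree G v + 1)                  ≡⟨ cong₂ _+_ (degree-complete G cG u) (degree-complete G cG v) ⟩
    n + n                                                ∎
    where
    regroup : ∀ x y → x + y + 2 ≡ (x + 1) + (y + 1)
    regroup = solve-∀
  upper : a + 3 ≤ n + n
  upper = ≤-trans (+-monoˡ-≤ 3 (minimal (incident G u v) (incident-precludes G u v u≢v))) (≤-reflexive incident-count)
  lower : n + n ≤ a + 3
  lower with a ≤? oddBound (4 + j)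
  ... | yes small = ⊥-elim (noAPM (complete-keepsAPM G cG (4 + j) n≡ F (≤-trans (≤-reflexive size≡a) small)))
  ... | no big = ≤-trans (≤-reflexive n+n≡) (+-monoˡ-≤ 3 (≰⇒> big))
    where
    n+n≡ : n + n ≡ suc (oddBound (4 + j)) + 3
    n+n≡ = trans (cong₂ _+_ n≡ n≡) (trans (sym (oddBound-large j)) (+-suc (oddBound (4 + j)) 3))

incident-size-complement : ∀ {n} (G : Graph n) p q → p ≢ q →
  size (incident G p q) + size (incident (complement G) p q) + 3 ≡ n + n
incident-size-complement {n} G p q p≢q =
  combine (size (incident G p q)) (size (incident H p q)) (b2n (adj G p q)) (b2n (adj H p q))
          (degree G p) (degree G q) (degree H p) (degree H q)
          (incident-size G p q p≢q) (incident-size H p q p≢q) one-of-two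
          (degree-complement G p) (degree-complement G q)
  where
  H = complement G
  one-of-two : b2n (adj G p q) + b2n (adj H p q) ≡ 1
  one-of-two = trans (cong (λ t → b2n (adj G p q) + b2n t) (compAdj-≢ (adj G) p q p≢q)) (b2n-not (adj G p q))
  combine : ∀ c c′ bG bH dGp dGq dHp dHq → c + bG ≡ dGp + dGq → c′ + bH ≡ dHp + dHq → bG + bH ≡ 1 →
            dGp + dHp + 1 ≡ n → dGq + dHq + 1 ≡ n → c + c′ + 3 ≡ n + n
  combine c c′ bG bH dGp dGq dHp dHq eG eH e1 ep eq = begin
    c + c′ + 3                            ≡⟨ cong (λ t → c + c′ + (t + 2)) (sym e1) ⟩
    c + c′ + ((bG + bH) + 2)              ≡⟨ regroup₁ c c′ bG bH ⟩
    (c + bG) + (c′ + bH) + 2              ≡⟨ cong₂ (λ s t → s + t + 2) eG eH ⟩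
    (dGp + dGq) + (dHp + dHq) + 2         ≡⟨ regroup₂ dGp dGq dHp dHq ⟩
    (dGp + dHp + 1) + (dGq + dHq + 1)     ≡⟨ cong₂ _+_ ep eq ⟩
    n + n                                 ∎
    where
    regroup₁ : ∀ c c′ bG bH → c + c′ + ((bG + bH) + 2) ≡ (c + bG) + (c′ + bH) + 2
    regroup₁ = solve-∀
    regroup₂ : ∀ a₁ a₂ e₁ e₂ → (a₁ + a₂) + (e₁ + e₂) + 2 ≡ (a₁ + e₁ + 1) + (a₂ + e₂ + 1)
    regroup₂ = solve-∀

degree-≥ : ∀ {n} (G : Graph n) y z → (∀ w → w ≢ y → w ≢ z → adj G y w ≡ true) → n ≤ degree G y + 1 + 1
degree-≥ {n} G y z adjacent =
  ≤-trans (≤-reflexive (sym sumFin-ones))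
          (≤-trans (sumFin-mono (λ w → atLeastOne w (w ≟ y) (w ≟ z))) (≤-reflexive collect))
  where
  collect : sumFin (λ w → b2n (adj G y w) + b2n (eqᵇ w y) + b2n (eqᵇ w z)) ≡ degree G y + 1 + 1
  collect = begin
    sumFin (λ w → b2n (adj G y w) + b2n (eqᵇ w y) + b2n (eqᵇ w z))
      ≡⟨ sumFin-+ {n} _ _ ⟩
    sumFin (λ w → b2n (adj G y w) + b2n (eqᵇ w y)) + sumFin (λ w → b2n (eqᵇ w z))
      ≡⟨ cong₂ _+_ (trans (sumFin-+ {n} _ _) (cong (degree G y +_) (sumFin-point y))) (sumFin-point z) ⟩
    degree G y + 1 + 1 ∎
  atLeastOne : ∀ w → Dec (w ≡ y) → Dec (w ≡ z) → 1 ≤ b2n (adj G y w) + b2n (eqᵇ w y) + b2n (eqᵇ w z)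
  atLeastOne w (yes refl) _ rewrite eqᵇ-refl w = ≤-trans (m≤n+m 1 (b2n (adj G w w))) (m≤m+n _ _)
  atLeastOne w (no _) (yes refl) rewrite eqᵇ-refl w = m≤n+m 1 _
  atLeastOne w (no w≢y) (no w≢z) rewrite adjacent w w≢y w≢z = s≤s z≤n

degree-≤1 : ∀ {n} (G : Graph n) y z → (∀ w → w ≢ y → w ≢ z → adj G z w ≡ false) → degree G z ≤ 1
degree-≤1 {n} G y z nonadjacent =
  ≤-trans (sumFin-mono (λ w → onlyY w (w ≟ y) (w ≟ z))) (≤-reflexive (sumFin-point y))
  where
  onlyY : ∀ w → Dec (w ≡ y) → Dec (w ≡ z) → b2n (adj G z w) ≤ b2n (eqᵇ w y)
  onlyY w (yes refl) _ rewrite eqᵇ-refl w = b2n≤1 _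
  onlyY w (no _) (yes refl) rewrite adj-irrefl G w = z≤n
  onlyY w (no w≢y) (no w≢z) rewrite nonadjacent w w≢y w≢z = z≤n

adj⇒≢ : ∀ {n} (G : Graph n) {p q} → adj G p q ≡ true → p ≢ q
adj⇒≢ G {p} e refl with trans (sym e) (adj-irrefl G p)
... | ()

record MixedVertex {n} (G : Graph n) : Set where
  constructor mixed
  field
    x y z : Fin n
    x≢z   : x ≢ z
    y≢z   : y ≢ z
    x~y   : adj G x y ≡ true
    x≁z   : adj G x z ≡ false

-- A graph with a non-edge {i, j} and an edge {k, l} has a mixed vertex: i itself if it
-- has a neighbour, and otherwise l, which is adjacent to k but not to the isolated i.
mixedVertex : ∀ {n} (G : Graph n) i j k l → i ≢ j → adj G i j ≡ false → adj G k l ≡ true → MixedVertex G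
mixedVertex G i j k l i≢j i≁j k~l with any? (λ y → adj G i y Boolᵖ.≟ true)
... | yes (y , i~y) = mixed i y j i≢j y≢j i~y i≁j
  where
  y≢j : y ≢ j
  y≢j refl with trans (sym i~y) i≁j
  ... | ()
... | no noNeighbour = mixed l k i l≢i k≢i l~k l≁i
  where
  l~k : adj G l k ≡ true
  l~k = trans (adj-sym G l k) k~l
  l≢i : l ≢ i
  l≢i refl = noNeighbour (k , l~k)
  k≢i : k ≢ i
  k≢i refl = noNeighbour (l , k~l)
  l≁i : adj G l i ≡ false
  l≁i with adj G l i in e
  ... | false = refl
  ... | true  = ⊥-elim (noNeighbour (l , trans (adj-sym G i l) e))

completeOrNonEdge : ∀ {n} (G : Graph n) → IsComplete G ⊎ (Σ (Fin n) λ i → Σ (Fin n) λ j → (i ≢ j) × (adj G i j ≡ false))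
completeOrNonEdge G with any? (λ i → any? (λ j → ¬? (i ≟ j) ×-dec (adj G i j Boolᵖ.≟ false)))
... | yes nonEdge = inj₂ nonEdge
... | no noNonEdge = inj₁ complete
  where
  complete : IsComplete G
  complete i j i≢j with adj G i j in e
  ... | true  = refl
  ... | false = ⊥-elim (noNonEdge (i , j , i≢j , e))

module Rigidity {n} (G : Graph n) (5≤n : 5 ≤ n) {a b : ℕ}
                (mpG : IsMP G a) (mpH : IsMP (complement G) b) (tight : a + b + 3 ≡ n + n) where

  H = complement G

  c : Fin n → Fin n → ℕ
  c p q = size (incident G p q)

  -- a and b are lower bounds for the two trivial preclusion sets at {p, q}, whose sizes
  -- add up to a + b; hence both bounds are attained, and every c p q equals a.
  c≡a : ∀ p q → p ≢ q → c p q ≡ a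
  c≡a p q p≢q = ≤-antisym c≤a a≤c
    where
    a≤c : a ≤ c p q
    a≤c = proj₂ mpG (incident G p q) (incident-precludes G p q p≢q)
    b≤c′ : b ≤ size (incident H p q)
    b≤c′ = proj₂ mpH (incident H p q) (incident-precludes H p q p≢q)
    sum≡ : c p q + size (incident H p q) ≡ a + b
    sum≡ = +-cancelʳ-≡ 3 _ _ (trans (incident-size-complement G p q p≢q) (sym tight))
    c≤a : c p q ≤ a
    c≤a = +-cancelʳ-≤ (size (incident H p q)) (c p q) a
            (≤-trans (≤-reflexive sum≡) (≤-trans (+-monoʳ-≤ a b≤c′) ≤-refl))

  c-const : ∀ p q r s → p ≢ q → r ≢ s → c p q ≡ c r s
  c-const p q r s p≢q r≢s = trans (c≡a p q p≢q) (sym (c≡a r s r≢s))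

  -- A mixed vertex x ~ y, x ≁ z forces deg y = deg z + 1 and, comparing {y, w} with
  -- {z, w}, y ~ w and z ≁ w for every other w; so deg y ≥ n − 2 and deg z ≤ 1, i.e. n ≤ 4.
  noMixedVertex : MixedVertex G → ⊥
  noMixedVertex (mixed x y z x≢z y≢z x~y x≁z) = 1+n≰n (≤-trans (≤-trans (s≤s (s≤s (s≤s (s≤s (s≤s z≤n))))) 5≤n) n≤4)
    where
    d = degree G
    x≢y : x ≢ y
    x≢y = adj⇒≢ G x~y
    dy≡dz+1 : d y ≡ d z + 1
    dy≡dz+1 = +-cancelˡ-≡ (d x) _ _ (begin
      d x + d y            ≡⟨ sym (incident-size G x y x≢y) ⟩
      c x y + b2n (adj G x y) ≡⟨ cong₂ (λ s t → s + b2n t) (c-const x y x z x≢y x≢z) x~y ⟩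
      c x z + 1            ≡⟨ cong (_+ 1) (trans (sym (+-identityʳ _)) (trans (cong (λ t → c x z + b2n t) (sym x≁z)) (incident-size G x z x≢z))) ⟩
      (d x + d z) + 1      ≡⟨ +-assoc (d x) (d z) 1 ⟩
      d x + (d z + 1)      ∎)
    compare : ∀ w → w ≢ y → w ≢ z → b2n (adj G y w) ≡ b2n (adj G z w) + 1
    compare w w≢y w≢z = +-cancelˡ-≡ (c y w) _ _ (begin
      c y w + b2n (adj G y w)        ≡⟨ incident-size G y w (w≢y ∘ sym) ⟩
      d y + d w                      ≡⟨ cong (_+ d w) dy≡dz+1 ⟩
      (d z + 1) + d w                ≡⟨ regroup (d z) (d w) ⟩
      (d z + d w) + 1                ≡⟨ cong (_+ 1) (sym (incident-size G z w (w≢z ∘ sym))) ⟩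
      (c z w + b2n (adj G z w)) + 1  ≡⟨ cong (λ t → (t + b2n (adj G z w)) + 1) (c-const z w y w (w≢z ∘ sym) (w≢y ∘ sym)) ⟩
      (c y w + b2n (adj G z w)) + 1  ≡⟨ +-assoc (c y w) _ 1 ⟩
      c y w + (b2n (adj G z w) + 1)  ∎)
      where
      regroup : ∀ s t → (s + 1) + t ≡ (s + t) + 1
      regroup = solve-∀
    forced : ∀ p q → b2n p ≡ b2n q + 1 → (p ≡ true) × (q ≡ false)
    forced true false _ = refl , refl
    forced true true ()
    forced false q e = ⊥-elim (0≢1+n (trans e (+-comm (b2n q) 1)))
    n≤4 : n ≤ 4
    n≤4 = ≤-trans (degree-≥ G y z (λ w w≢y w≢z → proj₁ (forced _ _ (compare w w≢y w≢z))))
            (≤-trans (≤-reflexive (cong (λ t → t + 1 + 1) dy≡dz+1))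
                     (+-monoˡ-≤ 1 (+-monoˡ-≤ 1 (+-monoˡ-≤ 1
                       (degree-≤1 G y z (λ w w≢y w≢z → proj₂ (forced _ _ (compare w w≢y w≢z))))))))

  -- Both G and its complement being incomplete would produce a mixed vertex.
  completeOrCoComplete : IsComplete G ⊎ IsComplete H
  completeOrCoComplete with completeOrNonEdge G | completeOrNonEdge H
  ... | inj₁ cG | _       = inj₁ cG
  ... | inj₂ _  | inj₁ cH = inj₂ cH
  ... | inj₂ (i , j , i≢j , i≁j) | inj₂ (k , l , k≢l , k≁ₕl) =
    ⊥-elim (noMixedVertex (mixedVertex G i j k l i≢j i≁j k~l))
    where
    k~l : adj G k l ≡ true
    k~l with adj G k l in e
    ... | true  = refl
    ... | false with trans (sym k≁ₕl) (trans (compAdj-≢ (adj G) k l k≢l) (cong not e))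
    ...   | ()

odd≥9 : ∀ n → n % 2 ≡ 1 → 9 ≤ n → Σ ℕ λ j → n ≡ suc ((4 + j) + (4 + j))
odd≥9 n odd 9≤n = k ∸ 4 , trans n≡ (cong (λ t → suc (t + t)) (sym (m+[n∸m]≡n 4≤k)))
  where
  k = n / 2
  twice : ∀ k → k * 2 ≡ k + k
  twice = solve-∀
  n≡ : n ≡ suc (k + k)
  n≡ = trans (m≡m%n+[m/n]*n n 2) (cong₂ _+_ odd (twice k))
  4≤k : 4 ≤ k
  4≤k = halve′ 4 k (≤-pred (≤-trans 9≤n (≤-reflexive n≡)))

-- 2n − 3 without truncated subtraction.
≡2n∸3⇔ : ∀ x n → 2 ≤ n → (x ≡ 2 * n ∸ 3) ⇔ (x + 3 ≡ n + n)
≡2n∸3⇔ x n 2≤n = mk⇔ (λ e → trans (cong (_+ 3) e) (trans (m∸n+n≡m 3≤2n) 2n≡))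
                     (λ e → trans (sym (m+n∸n≡m x 3)) (trans (cong (_∸ 3) e) (cong (_∸ 3) (sym 2n≡))))
  where
  2n≡ : 2 * n ≡ n + n
  2n≡ = cong (n +_) (+-identityʳ n)
  3≤2n : 3 ≤ 2 * n
  3≤2n = ≤-trans (+-mono-≤ (≤-trans (s≤s z≤n) 2≤n) 2≤n) (≤-reflexive (sym 2n≡))

theorem5p4 : (n : ℕ) → n % 2 ≡ 1 → 9 ≤ n → (G : Graph n) → (a b : ℕ) →
    IsMP G a → IsMP (complement G) b →
    ((a + b ≡ 2 * n ∸ 3) ⇔ (IsComplete G ⊎ IsComplete (complement G)))
theorem5p4 n odd 9≤n G a b mpG mpH with odd≥9 n odd 9≤n
... | j , n≡ = mk⇔ (Rigidity.completeOrCoComplete G 5≤n mpG mpH ∘ Equivalence.to sum⇔)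
                   (Equivalence.from sum⇔ ∘ extremal)
  where
  5≤n : 5 ≤ n
  5≤n = ≤-trans (s≤s (s≤s (s≤s (s≤s (s≤s z≤n))))) 9≤n
  2≤n : 2 ≤ n
  2≤n = ≤-trans (s≤s (s≤s z≤n)) 5≤n
  sum⇔ : (a + b ≡ 2 * n ∸ 3) ⇔ (a + b + 3 ≡ n + n)
  sum⇔ = ≡2n∸3⇔ (a + b) n 2≤n
  extremal : IsComplete G ⊎ IsComplete (complement G) → a + b + 3 ≡ n + n
  extremal (inj₁ cG) rewrite mp-edgeless (complement G) 2≤n (complete⇒complement-edgeless G cG) mpH
                            | +-identityʳ a = mp-complete G cG j n≡ mpG
  extremal (inj₂ cH) rewrite mp-edgeless G 2≤n (complement-complete⇒edgeless G cH) mpG = mp-complete (complement G) cH j n≡ mpH
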